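{- Let $S$ be a set of positive integers and let $M$ be a set of nonnegative integers with $0\in M$. Let $n$ be a positive integer. Then $$p(n;S,M)\le \prod_{a\in S}M(n/a).$$ Further, there exists at least one integer $r$ with $0\le r\le n^2$ such that $$p(r;S,M)\ge \frac{1}{n^2+1}\prod_{a\in S}M(n/a).$$ If moreover $m\mapsto p(m;S,M)$ is a nondecreasing function of $m$, then $$p(n;S,M)\ge \frac{1}{n+1}\prod_{a\in S}M(\sqrt{n}/a).$$
   Context: For a set $M$ of nonnegative integers, $M(x)=|\{\mu\in M:\mu\le x\}|$ is its counting function (so, since $0\in M$, $M(x)=1$ for $0\le x<1$, and the products above have only finitely many factors different from $1$). $p(n;S,M)$ denotes the number of partitions of $n$ all of whose parts belong to $S$ and such that the multiplicity of each part belongs to $M$. -}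

module Defs where

open import Data.Nat using (ℕ; zero; suc; _+_; _*_; _∸_; _≤ᵇ_; _≡ᵇ_)
open import Data.Bool using (Bool; true; false; if_then_else_; _∧_; _∨_; not)

-- Sets of naturals are given by their (Boolean) characteristic functions.

countUpTo : (ℕ → Bool) → ℕ → ℕ
countUpTo P zero    = if P zero then 1 else 0
countUpTo P (suc b) = (if P (suc b) then 1 else 0) + countUpTo P b

sumUpTo : ℕ → (ℕ → ℕ) → ℕ
sumUpTo zero    f = f zero
sumUpTo (suc b) f = f (suc b) + sumUpTo b f

prodFrom1 : ℕ → (ℕ → ℕ) → ℕ
prodFrom1 zero    f = 1
prodFrom1 (suc b) f = f (suc b) * prodFrom1 b f

-- Multiplicity j is allowed for part a: either the part does not occur
-- (j = 0), or a ∈ S and j ∈ M.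
allowed : (S M : ℕ → Bool) → ℕ → ℕ → Bool
allowed S M a j = (j ≡ᵇ 0) ∨ (S a ∧ M j)

-- parts S M k m = number of multiplicity vectors (j₁,…,j_k) ∈ ℕᵏ with
-- Σ i·jᵢ = m and each (i , jᵢ) allowed, i.e. the number of partitions of m
-- into parts from {1,…,k} ∩ S whose multiplicities lie in M.
parts : (S M : ℕ → Bool) → ℕ → ℕ → ℕ
parts S M zero    m = if m ≡ᵇ 0 then 1 else 0
parts S M (suc k) m =
  sumUpTo m (λ j → if allowed S M (suc k) j ∧ (suc k * j ≤ᵇ m)
                   then parts S M k (m ∸ suc k * j) else 0)

-- p(m; S, M): every part of a partition of m is ≤ m, so it suffices to use
-- parts from {1,…,m}.
p : (S M : ℕ → Bool) → ℕ → ℕ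
p S M m = parts S M m m

-- M(n/a) = |{μ ∈ M : μ ≤ n/a}| = |{μ ∈ M : μ·a ≤ n}|  (for a ≥ 1 such μ are ≤ n)
Mdiv : (M : ℕ → Bool) → ℕ → ℕ → ℕ
Mdiv M n a = countUpTo (λ μ → M μ ∧ (μ * a ≤ᵇ n)) n

-- M(√n/a) = |{μ ∈ M : μ ≤ √n/a}| = |{μ ∈ M : (μ·a)² ≤ n}|  (a ≥ 1)
Msqrt : (M : ℕ → Bool) → ℕ → ℕ → ℕ
Msqrt M n a = countUpTo (λ μ → M μ ∧ ((μ * a) * (μ * a) ≤ᵇ n)) n

-- ∏_{a ∈ S} M(n/a).  For a > n (and a ∈ S) the factor is M(0) = 1 since 0 ∈ M,
-- so the product may be restricted to 1 ≤ a ≤ n.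
prodDiv : (S M : ℕ → Bool) → ℕ → ℕ
prodDiv S M n = prodFrom1 n (λ a → if S a then Mdiv M n a else 1)

-- ∏_{a ∈ S} M(√n/a); likewise factors with a > n (indeed a > √n) equal 1.
prodSqrt : (S M : ℕ → Bool) → ℕ → ℕ
prodSqrt S M n = prodFrom1 n (λ a → if S a then Msqrt M n a else 1)

module Submission where

-- Here parts S M k m counts the multiplicity vectors (j₁, …, j_k) with
-- Σ a·j_a = m and every j_a admissible for the part a.  The proof rests on
-- comparing these vectors with "boxes": box B w a is the number of admissible
-- multiplicities j ≤ B of the part a with a·j ≤ w a.
--
-- In a vector of total m ≤ N every coordinate
--    satisfies a·j_a ≤ N, so parts k m ≤ ∏_{a ≤ k} box N N a.
--  * Lower bound (box-≤-cumulative).  Every vector of the box with bounds w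
--    has total at most Σ_{a ≤ k} w a.
--
-- With w ≡ n the box is exactly ∏_{a ∈ S} M(n/a) (div-factor≡box), which gives
-- the first claim and, by pigeonhole over r ≤ n², the second.  With ⌊√n⌋ = s
-- and w a = s for a ≤ s (0 otherwise) the box contains ∏_{a ∈ S} M(√n/a) and
-- has total weight s² ≤ n; monotonicity of p then gives the third claim.

open import Defs
open import Data.Nat using (ℕ; _+_; _*_; _≤_)
open import Data.Bool using (Bool; true; false)
open import Data.Product using (_×_; ∃-syntax)
open import Relation.Binary.PropositionalEquality using (_≡_)

open import Data.Nat using (zero; suc; _∸_; _<_; _≤?_; _≤ᵇ_; _≡ᵇ_; z≤n; s≤s; s≤s⁻¹)
open import Data.Nat.Properties
open import Algebra.Properties.CommutativeSemigroup +-commutativeSemigroup using (interchange)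
open import Data.Bool using (if_then_else_; _∧_; _∨_; T)
open import Data.Bool.Properties using (T-∧; T-≡; T?)
open import Data.Empty using (⊥-elim)
open import Data.Product using (_,_; proj₁; proj₂)
open import Data.Sum using (inj₁; inj₂)
open import Data.Unit using (tt)
open import Function.Bundles using (Equivalence)
open import Relation.Nullary using (¬_; yes; no; contradiction)
open import Relation.Binary.PropositionalEquality using (refl; sym; trans; cong; cong₂; subst₂; module ≡-Reasoning)

∧-intro : ∀ {a b} → T a → T b → T (a ∧ b)
∧-intro ta tb = Equivalence.from T-∧ (ta , tb)

∧-elim : ∀ {a b} → T (a ∧ b) → T a × T b
∧-elim = Equivalence.to T-∧

-- suc s ≤ᵇ suc r unfolds to s <ᵇ suc r, which is not literally s ≤ᵇ r.
≤ᵇ-suc : ∀ s r → (suc s ≤ᵇ suc r) ≡ (s ≤ᵇ r)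
≤ᵇ-suc zero    r = refl
≤ᵇ-suc (suc s) r = refl

if-mono : ∀ (b c : Bool) {x y : ℕ} → (T b → T c × x ≤ y) →
  (if b then x else 0) ≤ (if c then y else 0)
if-mono false c     h = z≤n
if-mono true  true  h = proj₂ (h tt)
if-mono true  false h = ⊥-elim (proj₁ (h tt))

if-zero : ∀ (b : Bool) x → ¬ T b → (if b then x else 0) ≡ 0
if-zero true  x nb = contradiction tt nb
if-zero false x nb = refl

sum-mono : ∀ b {f g : ℕ → ℕ} → (∀ j → f j ≤ g j) → sumUpTo b f ≤ sumUpTo b g
sum-mono zero    h = h 0
sum-mono (suc b) h = +-mono-≤ (h (suc b)) (sum-mono b h)

sum-cong : ∀ b {f g : ℕ → ℕ} → (∀ j → f j ≡ g j) → sumUpTo b f ≡ sumUpTo b g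
sum-cong zero    h = h 0
sum-cong (suc b) h = cong₂ _+_ (h (suc b)) (sum-cong b h)

sum-extend : ∀ {b b′} (f : ℕ → ℕ) → b ≤ b′ → sumUpTo b f ≤ sumUpTo b′ f
sum-extend {b} {zero}   f z≤n = ≤-refl
sum-extend {b} {suc b′} f b≤b′ with m≤n⇒m<n∨m≡n b≤b′
... | inj₁ b<b′ = ≤-trans (sum-extend f (s≤s⁻¹ b<b′)) (m≤n+m _ (f (suc b′)))
... | inj₂ refl = ≤-refl

sum-+ : ∀ b (f g : ℕ → ℕ) → sumUpTo b (λ j → f j + g j) ≡ sumUpTo b f + sumUpTo b g
sum-+ zero    f g = refl
sum-+ (suc b) f g = trans (cong (f (suc b) + g (suc b) +_) (sum-+ b f g))
  (interchange (f (suc b)) (g (suc b)) (sumUpTo b f) (sumUpTo b g))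

sum-swap : ∀ B R (F : ℕ → ℕ → ℕ) →
  sumUpTo B (λ j → sumUpTo R (F j)) ≡ sumUpTo R (λ r → sumUpTo B (λ j → F j r))
sum-swap zero    R F = refl
sum-swap (suc B) R F = trans (cong (sumUpTo R (F (suc B)) +_) (sum-swap B R F))
  (sym (sum-+ R (F (suc B)) (λ r → sumUpTo B (λ j → F j r))))

sum-peel : ∀ R (f : ℕ → ℕ) → sumUpTo (suc R) f ≡ f 0 + sumUpTo R (λ r → f (suc r))
sum-peel zero    f = +-comm (f 1) (f 0)
sum-peel (suc R) f = begin
    f (suc (suc R)) + sumUpTo (suc R) f
  ≡⟨ cong (f (suc (suc R)) +_) (sum-peel R f) ⟩
    f (suc (suc R)) + (f 0 + rest)
  ≡⟨ sym (+-assoc (f (suc (suc R))) (f 0) rest) ⟩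
    (f (suc (suc R)) + f 0) + rest
  ≡⟨ cong (_+ rest) (+-comm (f (suc (suc R))) (f 0)) ⟩
    (f 0 + f (suc (suc R))) + rest
  ≡⟨ +-assoc (f 0) (f (suc (suc R))) rest ⟩
    f 0 + sumUpTo (suc R) (λ r → f (suc r)) ∎
  where
  open ≡-Reasoning
  rest = sumUpTo R (λ r → f (suc r))

sum-shift : ∀ s R (g : ℕ → ℕ) → s ≤ R →
  sumUpTo R (λ r → if s ≤ᵇ r then g (r ∸ s) else 0) ≡ sumUpTo (R ∸ s) g
sum-shift zero    R       g _         = refl
sum-shift (suc s) (suc R) g (s≤s s≤R) = begin
    sumUpTo (suc R) (λ r → if suc s ≤ᵇ r then g (r ∸ suc s) else 0)
  ≡⟨ sum-peel R (λ r → if suc s ≤ᵇ r then g (r ∸ suc s) else 0) ⟩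
    sumUpTo R (λ r → if suc s ≤ᵇ suc r then g (r ∸ s) else 0)
  ≡⟨ sum-cong R (λ r → cong (λ b → if b then g (r ∸ s) else 0) (≤ᵇ-suc s r)) ⟩
    sumUpTo R (λ r → if s ≤ᵇ r then g (r ∸ s) else 0)
  ≡⟨ sum-shift s R g s≤R ⟩
    sumUpTo (R ∸ s) g ∎
  where open ≡-Reasoning

sum-truncate : ∀ {G H : ℕ → ℕ} r B → (∀ j → G j ≤ H j) → (∀ j → r < j → G j ≡ 0) →
  sumUpTo B G ≤ sumUpTo r H
sum-truncate r zero    G≤H _ = ≤-trans (G≤H 0) (sum-extend {b′ = r} _ z≤n)
sum-truncate r (suc B) G≤H vanish with suc B ≤? r
... | yes B<r = ≤-trans (sum-mono (suc B) G≤H) (sum-extend _ B<r)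
... | no  B≮r rewrite vanish (suc B) (≰⇒> B≮r) = sum-truncate r B G≤H vanish

if-≤-sum : ∀ (b : Bool) x R (c : ℕ → Bool) (g : ℕ → ℕ) →
  (T b → x ≤ sumUpTo R (λ r → if c r then g r else 0)) →
  (if b then x else 0) ≤ sumUpTo R (λ r → if b ∧ c r then g r else 0)
if-≤-sum true  x R c g h = h tt
if-≤-sum false x R c g h = z≤n

sum-≤-const : ∀ R (f : ℕ → ℕ) c → (∀ r → r ≤ R → f r ≤ c) → sumUpTo R f ≤ suc R * c
sum-≤-const zero    f c h = ≤-trans (h 0 z≤n) (≤-reflexive (sym (+-identityʳ c)))
sum-≤-const (suc R) f c h =
  +-mono-≤ (h (suc R) ≤-refl) (sum-≤-const R f c (λ r r≤R → h r (m≤n⇒m≤1+n r≤R)))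

pigeonhole : ∀ R (f : ℕ → ℕ) → ∃[ r ] (r ≤ R × sumUpTo R f ≤ suc R * f r)
pigeonhole zero    f = 0 , z≤n , ≤-reflexive (sym (+-identityʳ (f 0)))
pigeonhole (suc R) f with pigeonhole R f
... | r , r≤R , bound with f r ≤? f (suc R)
...   | yes fr≤ = suc R , ≤-refl ,
          +-monoʳ-≤ (f (suc R)) (≤-trans bound (*-monoʳ-≤ (suc R) fr≤))
...   | no  fr≰ = r , m≤n⇒m≤1+n r≤R , +-mono-≤ (<⇒≤ (≰⇒> fr≰)) bound

sumFrom1 : (ℕ → ℕ) → ℕ → ℕ
sumFrom1 w zero    = 0
sumFrom1 w (suc k) = w (suc k) + sumFrom1 w k

sumFrom1-const : ∀ c k → sumFrom1 (λ _ → c) k ≡ k * c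
sumFrom1-const c zero    = refl
sumFrom1-const c (suc k) = cong (c +_) (sumFrom1-const c k)

indicator-mul : ∀ (b : Bool) X → (if b then 1 else 0) * X ≡ (if b then X else 0)
indicator-mul true  X = +-identityʳ X
indicator-mul false X = refl

count-mul : ∀ (P : ℕ → Bool) B X → countUpTo P B * X ≡ sumUpTo B (λ j → if P j then X else 0)
count-mul P zero    X = indicator-mul (P 0) X
count-mul P (suc B) X = trans (*-distribʳ-+ X (if P (suc B) then 1 else 0) (countUpTo P B))
  (cong₂ _+_ (indicator-mul (P (suc B)) X) (count-mul P B X))

count-mono : ∀ {P Q : ℕ → Bool} b → (∀ j → T (P j) → T (Q j)) → countUpTo P b ≤ countUpTo Q b
count-mono {P} {Q} zero    h = if-mono (P 0) (Q 0) (λ t → h 0 t , ≤-refl)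
count-mono {P} {Q} (suc b) h =
  +-mono-≤ (if-mono (P (suc b)) (Q (suc b)) (λ t → h (suc b) t , ≤-refl)) (count-mono b h)

count-cong : ∀ {P Q : ℕ → Bool} b → (∀ j → P j ≡ Q j) → countUpTo P b ≡ countUpTo Q b
count-cong {P} {Q} zero    h = cong (λ x → if x then 1 else 0) (h 0)
count-cong {P} {Q} (suc b) h = cong₂ _+_ (cong (λ x → if x then 1 else 0) (h (suc b))) (count-cong b h)

count-pos : ∀ {P : ℕ → Bool} b → T (P 0) → 1 ≤ countUpTo P b
count-pos {P} zero    t = if-mono true (P 0) (λ _ → t , ≤-refl)
count-pos {P} (suc b) t = ≤-trans (count-pos b t) (m≤n+m _ _)

count-zero : ∀ b → countUpTo (_≡ᵇ 0) b ≡ 1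
count-zero zero    = refl
count-zero (suc b) = count-zero b

prod-mono : ∀ k {f g : ℕ → ℕ} → (∀ a → f a ≤ g a) → prodFrom1 k f ≤ prodFrom1 k g
prod-mono zero    h = ≤-refl
prod-mono (suc k) h = *-mono-≤ (h (suc k)) (prod-mono k h)

prod-cong : ∀ k {f g : ℕ → ℕ} → (∀ a → f a ≡ g a) → prodFrom1 k f ≡ prodFrom1 k g
prod-cong zero    h = refl
prod-cong (suc k) h = cong₂ _*_ (h (suc k)) (prod-cong k h)

greatest : ∀ (P : ℕ → Bool) → T (P 0) → ∀ N →
  ∃[ s ] (s ≤ N × T (P s) × (∀ t → t ≤ N → T (P t) → t ≤ s))
greatest P P0 zero = 0 , z≤n , P0 , λ { .0 z≤n _ → z≤n }
greatest P P0 (suc N) with T? (P (suc N))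
... | yes PN = suc N , ≤-refl , PN , λ t t≤ _ → t≤
... | no ¬PN with greatest P P0 N
...   | s , s≤N , Ps , maximal = s , m≤n⇒m≤1+n s≤N , Ps , below
  where
  below : ∀ t → t ≤ suc N → T (P t) → t ≤ s
  below t t≤ Pt with m≤n⇒m<n∨m≡n t≤
  ... | inj₁ t<  = maximal t (s≤s⁻¹ t<) Pt
  ... | inj₂ refl = contradiction Pt ¬PN

square-bound : ∀ {n} t → t * t ≤ n → t ≤ n
square-bound zero    _  = z≤n
square-bound (suc t) sq = ≤-trans (m≤m*n (suc t) (suc t)) sq

floor-sqrt : ∀ n → ∃[ s ] (s * s ≤ n × (∀ t → t * t ≤ n → t ≤ s))
floor-sqrt n with greatest (λ t → t * t ≤ᵇ n) tt n
... | s , _ , s² , maximal =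
  s , ≤ᵇ⇒≤ _ _ s² , λ t t² → maximal t (square-bound t t²) (≤⇒≤ᵇ t²)

capped : ℕ → ℕ → ℕ → ℕ
capped s c a = if a ≤ᵇ s then c else 0

capped-below : ∀ {s a} c → a ≤ s → capped s c a ≡ c
capped-below c a≤s rewrite Equivalence.to T-≡ (≤⇒≤ᵇ a≤s) = refl

sumFrom1-capped : ∀ s c k → s ≤ k → sumFrom1 (capped s c) k ≡ s * c
sumFrom1-capped s c k s≤k with m≤n⇒m<n∨m≡n s≤k
... | inj₂ refl = below k ≤-refl
  where
  below : ∀ k → k ≤ s → sumFrom1 (capped s c) k ≡ k * c
  below zero    _   = refl
  below (suc k) k<s = cong₂ _+_ (capped-below c k<s) (below k (≤-trans (n≤1+n k) k<s))
sumFrom1-capped s c (suc k) _ | inj₁ s<k =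
  cong₂ _+_ (if-zero _ c (λ t → <⇒≱ s<k (≤ᵇ⇒≤ _ _ t))) (sumFrom1-capped s c k (s≤s⁻¹ s<k))

module _ (S M : ℕ → Bool) where

  term : ℕ → ℕ → ℕ → ℕ
  term k m j = if allowed S M (suc k) j ∧ (suc k * j ≤ᵇ m) then parts S M k (m ∸ suc k * j) else 0

  box : ℕ → (ℕ → ℕ) → ℕ → ℕ
  box B w a = countUpTo (λ j → allowed S M a j ∧ (a * j ≤ᵇ w a)) B

  zero-admissible : ∀ a b → T (allowed S M a 0 ∧ (a * 0 ≤ᵇ b))
  zero-admissible a b = ≤⇒≤ᵇ (≤-trans (≤-reflexive (*-zeroʳ a)) z≤n)

  -- Upper bound: a vector of total m ≤ N lies in the box with bound N.
  parts-≤-box : ∀ k m N → m ≤ N → parts S M k m ≤ prodFrom1 k (box N (λ _ → N))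
  parts-≤-box zero    zero    N _   = ≤-refl
  parts-≤-box zero    (suc m) N _   = z≤n
  parts-≤-box (suc k) m       N m≤N = begin
      sumUpTo m (term k m)
    ≤⟨ sum-mono m (λ j → if-mono _ (Q j) (term-bound j)) ⟩
      sumUpTo m (λ j → if Q j then Π else 0)
    ≤⟨ sum-extend _ m≤N ⟩
      sumUpTo N (λ j → if Q j then Π else 0)
    ≡⟨ sym (count-mul Q N Π) ⟩
      box N (λ _ → N) (suc k) * Π ∎
    where
    open ≤-Reasoning
    Π = prodFrom1 k (box N (λ _ → N))
    Q : ℕ → Bool
    Q j = allowed S M (suc k) j ∧ (suc k * j ≤ᵇ N)
    term-bound : ∀ j → T (allowed S M (suc k) j ∧ (suc k * j ≤ᵇ m)) →
                 T (Q j) × parts S M k (m ∸ suc k * j) ≤ Π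
    term-bound j t with ∧-elim {allowed S M (suc k) j} {suc k * j ≤ᵇ m} t
    ... | adm , fits = ∧-intro adm (≤⇒≤ᵇ (≤-trans (≤ᵇ⇒≤ (suc k * j) m fits) m≤N))
                     , parts-≤-box k (m ∸ suc k * j) N (≤-trans (m∸n≤m m (suc k * j)) m≤N)

  -- Lower bound: a box of total weight ≤ R injects into the vectors of total
  -- ≤ R.  Induct on k, splitting by the multiplicity j of the largest part.
  box-≤-cumulative : ∀ B (w : ℕ → ℕ) k R → sumFrom1 w k ≤ R →
    prodFrom1 k (box B w) ≤ sumUpTo R (parts S M k)
  box-≤-cumulative B w zero    R _ = sum-extend {b′ = R} (parts S M 0) z≤n
  box-≤-cumulative B w (suc k) R weight = begin
      box B w d * Π
    ≡⟨ count-mul Q B Π ⟩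
      sumUpTo B (λ j → if Q j then Π else 0)
    ≤⟨ sum-mono B (λ j → if-≤-sum (Q j) Π R (λ r → d * j ≤ᵇ r) (λ r → parts S M k (r ∸ d * j))
                           (shifted-bound j)) ⟩
      sumUpTo B (λ j → sumUpTo R (G j))
    ≡⟨ sum-swap B R G ⟩
      sumUpTo R (λ r → sumUpTo B (λ j → G j r))
    ≤⟨ sum-mono R (λ r → sum-truncate r B (G≤term r) (G-vanishes r)) ⟩
      sumUpTo R (parts S M d) ∎
    where
    open ≤-Reasoning
    d = suc k
    Π = prodFrom1 k (box B w)
    Q : ℕ → Bool
    Q j = allowed S M d j ∧ (d * j ≤ᵇ w d)
    -- G j r: vectors of total r whose last coordinate j lies in the box.
    G : ℕ → ℕ → ℕ
    G j r = if Q j ∧ (d * j ≤ᵇ r) then parts S M k (r ∸ d * j) else 0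

    shifted-bound : ∀ j → T (Q j) →
      Π ≤ sumUpTo R (λ r → if d * j ≤ᵇ r then parts S M k (r ∸ d * j) else 0)
    shifted-bound j q = ≤-trans (box-≤-cumulative B w k (R ∸ d * j) rest)
                                (≤-reflexive (sym (sum-shift (d * j) R (parts S M k) dj≤R)))
      where
      dj≤w : d * j ≤ w d
      dj≤w = ≤ᵇ⇒≤ _ _ (proj₂ (∧-elim {allowed S M d j} q))
      rest : sumFrom1 w k ≤ R ∸ d * j
      rest = m+n≤o⇒m≤o∸n (sumFrom1 w k)
        (≤-trans (≤-reflexive (+-comm (sumFrom1 w k) (d * j))) (≤-trans (+-monoˡ-≤ _ dj≤w) weight))
      dj≤R : d * j ≤ R
      dj≤R = ≤-trans dj≤w (m+n≤o⇒m≤o (w d) weight)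

    G≤term : ∀ r j → G j r ≤ term k r j
    G≤term r j = if-mono _ _ λ t → let (q , fits) = ∧-elim t
                                   in ∧-intro (proj₁ (∧-elim {allowed S M d j} q)) fits , ≤-refl

    G-vanishes : ∀ r j → r < j → G j r ≡ 0
    G-vanishes r j r<j = if-zero _ _ λ t →
      <⇒≱ (<-≤-trans r<j (m≤n*m j d)) (≤ᵇ⇒≤ _ _ (proj₂ (∧-elim {Q j} t)))

  term-zero : ∀ k r → term k r 0 ≡ parts S M k r
  term-zero k r rewrite *-zeroʳ k = refl

  parts-grow : ∀ k r → parts S M k r ≤ parts S M (suc k) r
  parts-grow k r = ≤-trans (≤-reflexive (sym (term-zero k r))) (sum-extend {b′ = r} (term k r) z≤n)

  -- A part larger than r cannot occur in a partition of r.
  parts-stable : ∀ k r → r ≤ k → parts S M (suc k) r ≤ parts S M k r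
  parts-stable k r r≤k =
    ≤-trans (sum-truncate 0 r (λ j → ≤-refl) too-large) (≤-reflexive (term-zero k r))
    where
    too-large : ∀ j → 0 < j → term k r j ≡ 0
    too-large (suc j) _ = if-zero _ _ λ t →
      <⇒≱ (<-≤-trans (s≤s r≤k) (m≤m*n (suc k) (suc j))) (≤ᵇ⇒≤ _ _ (proj₂ (∧-elim {allowed S M (suc k) (suc j)} t)))

  parts-mono : ∀ {k k′} r → k ≤ k′ → parts S M k r ≤ parts S M k′ r
  parts-mono {k} {zero}   r z≤n = ≤-refl
  parts-mono {k} {suc k′} r k≤ with m≤n⇒m<n∨m≡n k≤
  ... | inj₁ k< = ≤-trans (parts-mono r (s≤s⁻¹ k<)) (parts-grow k′ r)
  ... | inj₂ refl = ≤-refl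

  parts-settle : ∀ k r → r ≤ k → parts S M k r ≤ p S M r
  parts-settle zero    .zero z≤n = ≤-refl
  parts-settle (suc k) r     r≤k with m≤n⇒m<n∨m≡n r≤k
  ... | inj₁ r<k  = ≤-trans (parts-stable k r (s≤s⁻¹ r<k)) (parts-settle k r (s≤s⁻¹ r<k))
  ... | inj₂ refl = ≤-refl

  parts-≤-p : ∀ k r → parts S M k r ≤ p S M r
  parts-≤-p k r with ≤-total k r
  ... | inj₁ k≤r = parts-mono r k≤r
  ... | inj₂ r≤k = parts-settle k r r≤k

  -- With the constant bound n the box is exactly ∏_{a ∈ S} M(n/a).  After the
  -- case split on S a, the admissible multiplicities of a are 0 together
  -- with M (which contains 0), resp. 0 alone.
  div-factor≡box : M 0 ≡ true → ∀ n a → (if S a then Mdiv M n a else 1) ≡ box n (λ _ → n) a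
  div-factor≡box M0 n a with S a
  ... | true  = count-cong n λ j → cong₂ _∧_ (sym (zero-or-M j)) (cong (_≤ᵇ n) (*-comm j a))
    where
    zero-or-M : ∀ j → ((j ≡ᵇ 0) ∨ M j) ≡ M j
    zero-or-M zero    = sym M0
    zero-or-M (suc j) = refl
  ... | false = trans (sym (count-zero n)) (count-cong n λ j → sym (only-zero j))
    where
    only-zero : ∀ j → (((j ≡ᵇ 0) ∨ false) ∧ (a * j ≤ᵇ n)) ≡ (j ≡ᵇ 0)
    only-zero zero    rewrite *-zeroʳ a = refl
    only-zero (suc j) = refl

  prodDiv≡box : M 0 ≡ true → ∀ n → prodDiv S M n ≡ prodFrom1 n (box n (λ _ → n))
  prodDiv≡box M0 n = prod-cong n (div-factor≡box M0 n)

  -- If s = ⌊√n⌋, then (μ·a)² ≤ n forces μ·a ≤ s, and a ≤ s when μ ≥ 1, so the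
  -- factor M(√n/a) fits into the box with the capped weight.
  sqrt-factor-≤-box : ∀ n s → (∀ t → t * t ≤ n → t ≤ s) →
    ∀ a → (if S a then Msqrt M n a else 1) ≤ box n (capped s s) a
  sqrt-factor-≤-box n s maximal a with S a
  ... | false = count-pos n (zero-admissible a (capped s s a))
  ... | true  = count-mono n admissible
    where
    admissible : ∀ j → T (M j ∧ ((j * a) * (j * a) ≤ᵇ n)) →
                 T (((j ≡ᵇ 0) ∨ M j) ∧ (a * j ≤ᵇ capped s s a))
    admissible zero    _ = zero-admissible a (capped s s a)
    admissible (suc j) t with ∧-elim t
    ... | inM , small = ∧-intro inM (≤⇒≤ᵇ fits)
      where
      ja≤s : suc j * a ≤ s
      ja≤s = maximal _ (≤ᵇ⇒≤ _ _ small)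
      fits : a * suc j ≤ capped s s a
      fits = subst₂ _≤_ (*-comm (suc j) a) (sym (capped-below s (≤-trans (m≤n*m a (suc j)) ja≤s))) ja≤s

lemma3 : (S M : ℕ → Bool) → S 0 ≡ false → M 0 ≡ true → (n : ℕ) → 1 ≤ n →
    (p S M n ≤ prodDiv S M n)
    × (∃[ r ] (r ≤ n * n × prodDiv S M n ≤ (n * n + 1) * p S M r))
    × ((∀ m m′ → m ≤ m′ → p S M m ≤ p S M m′) → prodSqrt S M n ≤ (n + 1) * p S M n)
lemma3 S M _ M0 n _ = upper , average , monotone
  where
  open ≤-Reasoning

  upper : p S M n ≤ prodDiv S M n
  upper = begin
    p S M n                              ≤⟨ parts-≤-box S M n n n ≤-refl ⟩
    prodFrom1 n (box S M n (λ _ → n))   ≡⟨ sym (prodDiv≡box S M M0 n) ⟩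
    prodDiv S M n                        ∎

  average : ∃[ r ] (r ≤ n * n × prodDiv S M n ≤ (n * n + 1) * p S M r)
  average with pigeonhole (n * n) (p S M)
  ... | r , r≤n² , large = r , r≤n² , (begin
    prodDiv S M n                            ≡⟨ prodDiv≡box S M M0 n ⟩
    prodFrom1 n (box S M n (λ _ → n))       ≤⟨ box-≤-cumulative S M n (λ _ → n) n (n * n)
                                                  (≤-reflexive (sumFrom1-const n n)) ⟩
    sumUpTo (n * n) (parts S M n)            ≤⟨ sum-mono (n * n) (parts-≤-p S M n) ⟩
    sumUpTo (n * n) (p S M)                  ≤⟨ large ⟩
    suc (n * n) * p S M r                    ≡⟨ cong (_* p S M r) (+-comm 1 (n * n)) ⟩
    (n * n + 1) * p S M r                    ∎)

  monotone : (∀ m m′ → m ≤ m′ → p S M m ≤ p S M m′) → prodSqrt S M n ≤ (n + 1) * p S M n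
  monotone p-mono with floor-sqrt n
  ... | s , s²≤n , maximal = begin
    prodSqrt S M n                     ≤⟨ prod-mono n (sqrt-factor-≤-box S M n s maximal) ⟩
    prodFrom1 n (box S M n (capped s s)) ≤⟨ box-≤-cumulative S M n (capped s s) n n
                                            (≤-trans (≤-reflexive (sumFrom1-capped s s n s≤n)) s²≤n) ⟩
    sumUpTo n (parts S M n)            ≤⟨ sum-mono n (parts-≤-p S M n) ⟩
    sumUpTo n (p S M)                  ≤⟨ sum-≤-const n (p S M) (p S M n) (λ r r≤n → p-mono r n r≤n) ⟩
    suc n * p S M n                    ≡⟨ cong (_* p S M n) (+-comm 1 n) ⟩
    (n + 1) * p S M n                  ∎
    where
    s≤n : s ≤ n
    s≤n = square-bound s s²≤n
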